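{- Let $p$ be a prime and $n\geq 1$ an integer, and write $M=\lfloor n/p\rfloor$. Let $H(n)=\prod_{i=1}^{n} i^{i}$ be the hyperfactorial. Then $$\nu_p\left[H(n)\right]\geq pM\left(\frac{n}{p-1}-\lfloor\log_p n\rfloor-1\right)-\frac{p}{2(p-1)}\left(M-1\right)\left(pM-2\right).$$
   Context: For a prime $p$ and a positive integer $m$, $\nu_p(m)=\max\{k\in\mathbb{N}: p^k\mid m\}$ denotes the $p$-adic valuation of $m$. $\lfloor x\rfloor$ is the floor function and $\log_p$ the base-$p$ logarithm. -}

module Defs where

open import Data.Nat using (ℕ; zero; suc; _*_; _^_; _≤_)
open import Data.Nat.Divisibility using (_∣_)
open import Data.Product using (_×_)

H : ℕ → ℕ
H zero    = 1
H (suc n) = H n * (suc n ^ suc n)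

IsValuation : ℕ → ℕ → ℕ → Set
IsValuation p m k = (p ^ k ∣ m) × (∀ j → p ^ j ∣ m → j ≤ k)

IsFloorLog : ℕ → ℕ → ℕ → Set
IsFloorLog p n k = (p ^ k ≤ n) × (∀ j → p ^ j ≤ n → j ≤ k)

{-# OPTIONS --safe #-}
-- The multiples of p in 1, …, n are p·i for 1 ≤ i ≤ M = ⌊n/p⌋, and (p·i)^(p·i) = p^(p·i) · (i^i)^p, so
-- ν_p(H n) = p · (T M + ν_p(H M)) with T M = M(M+1)/2; unfolding this L times bounds ν_p(H n) from below by
-- p·V with V = Σ_{i ≤ M} i · min(L + 1, ν_p(p·i)). Multiplying the claim by 2(p − 1) = 2d and using
-- n ≤ pM + d reduces it to the inequality of natural numbers
--   M(pM + p + 2) ≤ 2d·V + 2d·L·M + 2      whenever M < p^L,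
-- proved by induction on L by splitting M = r + pM′ into its last base-p digit r and the rest M′.
-- If M′ = 0 this is 3r ≤ r² + 2; otherwise p times the inequality for M′ leaves a nonnegative polynomial slack.
module Submission where

module HyperfactorialValuation where

  open import Defs
  open import Data.Nat
  open import Data.Nat.Properties
  open import Data.Nat.Divisibility
  open import Data.Nat.DivMod
  open import Data.Nat.Tactic.RingSolver using (solve-∀)
  open import Data.Product using (_,_; proj₂)
  open import Data.Sum using (inj₁; inj₂)
  open import Algebra.Properties.CommutativeSemigroup *-commutativeSemigroup using (interchange)
  open import Relation.Binary.PropositionalEquality

  triangular : ℕ → ℕ
  triangular zero    = 0
  triangular (suc m) = triangular m + suc m

  2*triangular≡m*[1+m] : ∀ m → 2 * triangular m ≡ m * suc m
  2*triangular≡m*[1+m] zero    = refl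
  2*triangular≡m*[1+m] (suc m) = begin
      2 * (triangular m + suc m)     ≡⟨ *-distribˡ-+ 2 (triangular m) (suc m) ⟩
      2 * triangular m + 2 * suc m   ≡⟨ cong (_+ 2 * suc m) (2*triangular≡m*[1+m] m) ⟩
      m * suc m + 2 * suc m          ≡⟨ *-distribʳ-+ (suc m) m 2 ⟨
      (m + 2) * suc m                ≡⟨ *-comm (m + 2) (suc m) ⟩
      suc m * (m + 2)                ≡⟨ cong (suc m *_) (+-comm m 2) ⟩
      suc m * suc (suc m)            ∎
    where open ≡-Reasoning

  ^-distribʳ-* : ∀ m n o → (m * n) ^ o ≡ m ^ o * n ^ o
  ^-distribʳ-* m n zero    = refl
  ^-distribʳ-* m n (suc o) = trans (cong (m * n *_) (^-distribʳ-* m n o)) (interchange m n (m ^ o) (n ^ o))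

  ^-monoˡ-∣ : ∀ {m n} o → m ∣ n → m ^ o ∣ n ^ o
  ^-monoˡ-∣ zero    _   = ∣-refl
  ^-monoˡ-∣ (suc o) m∣n = *-pres-∣ m∣n (^-monoˡ-∣ o m∣n)

  H-mono-∣ : ∀ {m n} → m ≤ n → H m ∣ H n
  H-mono-∣ {n = zero}  z≤n   = ∣-refl
  H-mono-∣ {n = suc n} m≤1+n with m≤n⇒m<n∨m≡n m≤1+n
  ... | inj₁ m<1+n = ∣m⇒∣m*n _ (H-mono-∣ (s≤s⁻¹ m<1+n))
  ... | inj₂ refl  = ∣-refl

  3m≤m*m+2 : ∀ m → 3 * m ≤ m * m + 2
  3m≤m*m+2 0               = z≤n
  3m≤m*m+2 1               = ≤-refl
  3m≤m*m+2 m@(suc (suc k)) = subst (3 * m ≤_) (slack k) (m≤m+n (3 * m) (k * suc k))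
    where
    slack : ∀ k → 3 * (2 + k) + k * (1 + k) ≡ (2 + k) * (2 + k) + 2
    slack = solve-∀

  d+3*r≤d*d+3*[d*r] : ∀ {d r} → r ≤ d → d + 3 * r ≤ d * d + 3 * (d * r)
  d+3*r≤d*d+3*[d*r] {zero}      z≤n = z≤n
  d+3*r≤d*d+3*[d*r] {d@(suc _)} {r} _ = +-mono-≤ (m≤m*n d d) (*-monoʳ-≤ 3 (m≤n*m r d))

  single-digit-bound : ∀ d m → m ≤ d →
    m * (m * suc d + suc d + 2) ≤ d * (m * suc m) + (2 * d * m + 2)
  single-digit-bound d m m≤d = begin
      m * (m * suc d + suc d + 2)             ≡⟨ expand d m ⟩
      d * (m * suc m) + (3 * m + m * m)       ≤⟨ +-monoʳ-≤ (d * (m * suc m)) (+-monoˡ-≤ (m * m) (3m≤m*m+2 m)) ⟩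
      d * (m * suc m) + (m * m + 2 + m * m)   ≤⟨ +-monoʳ-≤ (d * (m * suc m)) (+-mono-≤ (+-monoˡ-≤ 2 m*m≤d*m) m*m≤d*m) ⟩
      d * (m * suc m) + (d * m + 2 + d * m)   ≡⟨ regroup d m ⟩
      d * (m * suc m) + (2 * d * m + 2)       ∎
    where
    open ≤-Reasoning
    m*m≤d*m : m * m ≤ d * m
    m*m≤d*m = *-monoˡ-≤ m m≤d
    expand : ∀ d m → m * (m * suc d + suc d + 2) ≡ d * (m * suc m) + (3 * m + m * m)
    expand = solve-∀
    regroup : ∀ d m → d * (m * suc m) + (d * m + 2 + d * m) ≡ d * (m * suc m) + (2 * d * m + 2)
    regroup = solve-∀

  multi-digit-inequality : ∀ d r M' L' → r ≤ d → 1 ≤ M' → 1 ≤ L' → let p = suc d ; M = r + M' * p in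
    M * (M * p + p + 2) + p * (2 * d * L' * M' + 2)
      ≤ d * (M * suc M) + (2 * d * suc L' * M + 2) + p * (M' * (M' * p + p + 2))
  multi-digit-inequality d r (suc m) (suc l) r≤d _ _ with m≤n⇒∃[o]m+o≡n r≤d
  ... | e , refl = +-cancelʳ-≤ (d + 3 * r) _ _ (begin
      A + (d + 3 * r)                     ≤⟨ +-mono-≤ (m≤m+n A slack) (d+3*r≤d*d+3*[d*r] r≤d) ⟩
      A + slack + (d * d + 3 * (d * r))   ≡⟨ slack-identity r e m l ⟨
      B + (d + 3 * r)                     ∎)
    where
    -- B − A = slack + (d − 1)(d + 3r); the last term is nonnegative because r ≤ d, but it has a
    -- negative coefficient, so d + 3r is added to both sides instead.
    open ≤-Reasoning
    p = suc d
    M = r + suc m * p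
    A = M * (M * p + p + 2) + p * (2 * d * suc l * suc m + 2)
    B = d * (M * suc M) + (2 * d * suc (suc l) * M + 2) + p * (suc m * (suc m * p + p + 2))
    slack = 2 * p * suc m * e + r * e + p * d * m + 2 * d * r * l
    slack-identity : ∀ r e m l → let d = r + e ; p = suc d ; M = r + suc m * p in
      d * (M * suc M) + (2 * d * suc (suc l) * M + 2) + p * (suc m * (suc m * p + p + 2)) + (d + 3 * r)
        ≡ M * (M * p + p + 2) + p * (2 * d * suc l * suc m + 2)
          + (2 * p * suc m * e + r * e + p * d * m + 2 * d * r * l) + (d * d + 3 * (d * r))
    slack-identity = solve-∀

  multi-digit-bound : ∀ d r M' L' Y → r ≤ d → 1 ≤ M' → 1 ≤ L' → let p = suc d ; M = r + M' * p in
    M' * (M' * p + p + 2) ≤ Y + (2 * d * L' * M' + 2) →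
    M * (M * p + p + 2) ≤ d * (M * suc M) + p * Y + (2 * d * suc L' * M + 2)
  multi-digit-bound d r M' L' Y r≤d 1≤M' 1≤L' bound = +-cancelʳ-≤ (p * c) _ _ (begin
      a + p * c            ≤⟨ multi-digit-inequality d r M' L' r≤d 1≤M' 1≤L' ⟩
      b + p * x            ≤⟨ +-monoʳ-≤ b (*-monoʳ-≤ p bound) ⟩
      b + p * (Y + c)      ≡⟨ regroup (d * (M * suc M)) (2 * d * suc L' * M + 2) Y c d ⟩
      b' + p * c           ∎)
    where
    open ≤-Reasoning
    p = suc d
    M = r + M' * p
    a = M * (M * p + p + 2)
    b = d * (M * suc M) + (2 * d * suc L' * M + 2)
    b' = d * (M * suc M) + p * Y + (2 * d * suc L' * M + 2)
    c = 2 * d * L' * M' + 2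
    x = M' * (M' * p + p + 2)
    regroup : ∀ t z Y c d → t + z + suc d * (Y + c) ≡ t + suc d * Y + z + suc d * c
    regroup = solve-∀

  module _ (d : ℕ) where
    private
      p : ℕ
      p = suc d

    [p^triangular*H]^p∣H[m*p] : ∀ m → (p ^ triangular m * H m) ^ p ∣ H (m * p)
    [p^triangular*H]^p∣H[m*p] zero    = ∣-reflexive (^-zeroˡ p)
    [p^triangular*H]^p∣H[m*p] (suc m) = begin
        (p ^ (triangular m + k) * (H m * k ^ k)) ^ p   ≡⟨ cong (λ y → (y * (H m * k ^ k)) ^ p) (^-distribˡ-+-* p (triangular m) k) ⟩
        (p ^ triangular m * p ^ k * (H m * k ^ k)) ^ p ≡⟨ cong (_^ p) (interchange (p ^ triangular m) (p ^ k) (H m) (k ^ k)) ⟩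
        (X * (p ^ k * k ^ k)) ^ p                      ≡⟨ ^-distribʳ-* X (p ^ k * k ^ k) p ⟩
        X ^ p * (p ^ k * k ^ k) ^ p                    ≡⟨ cong (λ y → X ^ p * y ^ p) (^-distribʳ-* p k k) ⟨
        X ^ p * ((p * k) ^ k) ^ p                      ≡⟨ cong (X ^ p *_) (^-*-assoc (p * k) k p) ⟩
        X ^ p * (p * k) ^ (k * p)                      ≡⟨ cong (λ y → X ^ p * y ^ (k * p)) (*-comm p k) ⟩
        X ^ p * (k * p) ^ (k * p)                      ∣⟨ *-monoˡ-∣ _ ([p^triangular*H]^p∣H[m*p] m) ⟩
        H (m * p) * (k * p) ^ (k * p)                  ∣⟨ *-monoˡ-∣ _ (H-mono-∣ (m≤n+m (m * p) d)) ⟩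
        H (k * p)                                      ∎
      where
      open ∣-Reasoning
      k = suc m
      X = p ^ triangular m * H m

    -- weightedValuation k m = Σ_{i=1}^{m} i · min(k + 1, ν_p(p·i)); for p^k > m it equals ν_p(H (p·m)) / p.
    weightedValuation : ℕ → ℕ → ℕ
    weightedValuation zero    m = triangular m
    weightedValuation (suc k) m = triangular m + weightedValuation k (m / p) * p

    p^[weightedValuation*p]∣H[m*p]     : ∀ k m → p ^ (weightedValuation k m * p) ∣ H (m * p)
    p^weightedValuation∣p^triangular*H : ∀ k m → p ^ weightedValuation k m ∣ p ^ triangular m * H m

    p^[weightedValuation*p]∣H[m*p] k m = begin
        p ^ (weightedValuation k m * p)   ≡⟨ ^-*-assoc p (weightedValuation k m) p ⟨
        (p ^ weightedValuation k m) ^ p   ∣⟨ ^-monoˡ-∣ p (p^weightedValuation∣p^triangular*H k m) ⟩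
        (p ^ triangular m * H m) ^ p      ∣⟨ [p^triangular*H]^p∣H[m*p] m ⟩
        H (m * p)                         ∎
      where open ∣-Reasoning

    p^weightedValuation∣p^triangular*H zero    m = m∣m*n (H m)
    p^weightedValuation∣p^triangular*H (suc k) m = begin
        p ^ (triangular m + weightedValuation k (m / p) * p)      ≡⟨ ^-distribˡ-+-* p (triangular m) _ ⟩
        p ^ triangular m * p ^ (weightedValuation k (m / p) * p)  ∣⟨ *-monoʳ-∣ (p ^ triangular m) (p^[weightedValuation*p]∣H[m*p] k (m / p)) ⟩
        p ^ triangular m * H (m / p * p)                          ∣⟨ *-monoʳ-∣ (p ^ triangular m) (H-mono-∣ (m/n*n≤m m p)) ⟩
        p ^ triangular m * H m                                    ∎
      where open ∣-Reasoning

    2*d*weightedValuation-unfold : ∀ k m →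
      2 * d * weightedValuation (suc k) m ≡ d * (m * suc m) + p * (2 * d * weightedValuation k (m / p))
    2*d*weightedValuation-unfold k m = begin
        2 * d * (triangular m + v * p)           ≡⟨ regroup d (triangular m) v ⟩
        d * (2 * triangular m) + p * (2 * d * v) ≡⟨ cong (λ t → d * t + p * (2 * d * v)) (2*triangular≡m*[1+m] m) ⟩
        d * (m * suc m) + p * (2 * d * v)        ∎
      where
      open ≡-Reasoning
      v = weightedValuation k (m / p)
      regroup : ∀ d t v → 2 * d * (t + v * suc d) ≡ d * (2 * t) + suc d * (2 * d * v)
      regroup = solve-∀

    weightedValuation-bound : ∀ L m → m < p ^ L →
      m * (m * p + p + 2) ≤ 2 * d * weightedValuation L m + (2 * d * L * m + 2)
    weightedValuation-bound-step : ∀ L m m' → m / p ≡ m' → m' < p ^ L →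
      m * (m * p + p + 2) ≤ d * (m * suc m) + p * (2 * d * weightedValuation L m') + (2 * d * suc L * m + 2)

    weightedValuation-bound zero    m m<1 rewrite n<1⇒n≡0 m<1 = z≤n
    weightedValuation-bound (suc L) m m<p^[1+L] =
      subst (m * (m * p + p + 2) ≤_) (cong (_+ (2 * d * suc L * m + 2)) (sym (2*d*weightedValuation-unfold L m)))
        (weightedValuation-bound-step L m (m / p) refl (m<n*o⇒m/o<n (subst (m <_) (*-comm p (p ^ L)) m<p^[1+L])))

    weightedValuation-bound-step L m zero m/p≡0 _ = begin
        m * (m * p + p + 2)                 ≤⟨ single-digit-bound d m (s≤s⁻¹ (m/n≡0⇒m<n m/p≡0)) ⟩
        d * (m * suc m) + (2 * d * m + 2)   ≤⟨ +-mono-≤ (m≤m+n (d * (m * suc m)) Y) (+-monoˡ-≤ 2 (*-monoˡ-≤ m (m≤m*n (2 * d) (suc L)))) ⟩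
        d * (m * suc m) + Y + (2 * d * suc L * m + 2) ∎
      where
      open ≤-Reasoning
      Y = p * (2 * d * weightedValuation L 0)
    weightedValuation-bound-step zero    m (suc m') _ (s≤s ())
    weightedValuation-bound-step (suc L) m (suc m') m/p≡1+m' m'<p^[1+L] =
      subst (λ x → x * (x * p + p + 2) ≤ d * (x * suc x) + p * Y + (2 * d * suc (suc L) * x + 2)) (sym m≡r+m'p)
        (multi-digit-bound d (m % p) (suc m') (suc L) Y (s≤s⁻¹ (m%n<n m p)) (s≤s z≤n) (s≤s z≤n)
          (weightedValuation-bound (suc L) (suc m') m'<p^[1+L]))
      where
      Y = 2 * d * weightedValuation (suc L) (suc m')
      m≡r+m'p : m ≡ m % p + suc m' * p
      m≡r+m'p = subst (λ q → m ≡ m % p + q * p) m/p≡1+m' (m≡m%n+[m/n]*n m p)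

  hyperfactorial-bound : ∀ d n v L → IsValuation (suc d) (H n) v → IsFloorLog (suc d) n L →
    let p = suc d ; M = n / p in
    p * M * (2 * n + 2 + p) ≤ p * (M * (2 * d * suc L + p * M) + 2) + v * (2 * d)
  hyperfactorial-bound d n v L ν≡v ⌊log⌋≡L = begin
      p * M * (2 * n + 2 + p)                                       ≤⟨ *-monoʳ-≤ (p * M) (+-monoˡ-≤ p (+-monoˡ-≤ 2 (*-monoʳ-≤ 2 n≤d+Mp))) ⟩
      p * M * (2 * (d + M * p) + 2 + p)                             ≡⟨ regroup₁ d M ⟩
      p * (M * (M * p + p + 2) + (M * (M * p) + 2 * d * M))         ≤⟨ *-monoʳ-≤ p (+-monoˡ-≤ _ (weightedValuation-bound d L M M<p^L)) ⟩
      p * (2 * d * V + (2 * d * L * M + 2) + (M * (M * p) + 2 * d * M)) ≡⟨ regroup₂ d M V L ⟩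
      p * (M * (2 * d * suc L + p * M) + 2) + V * p * (2 * d)       ≤⟨ +-monoʳ-≤ _ (*-monoˡ-≤ (2 * d) V*p≤v) ⟩
      p * (M * (2 * d * suc L + p * M) + 2) + v * (2 * d)           ∎
    where
    open ≤-Reasoning
    p = suc d
    M = n / p
    V = weightedValuation d L M
    n≤d+Mp : n ≤ d + M * p
    n≤d+Mp = subst (_≤ d + M * p) (sym (m≡m%n+[m/n]*n n p)) (+-monoˡ-≤ (M * p) (s≤s⁻¹ (m%n<n n p)))
    M<p^L : M < p ^ L
    M<p^L = m<n*o⇒m/o<n (subst (n <_) (*-comm p (p ^ L)) (≰⇒> (λ p^[1+L]≤n → 1+n≰n (proj₂ ⌊log⌋≡L (suc L) p^[1+L]≤n))))
    V*p≤v : V * p ≤ v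
    V*p≤v = proj₂ ν≡v (V * p) (∣-trans (p^[weightedValuation*p]∣H[m*p] d L M) (H-mono-∣ (m/n*n≤m n p)))
    regroup₁ : ∀ d M → suc d * M * (2 * (d + M * suc d) + 2 + suc d)
                       ≡ suc d * (M * (M * suc d + suc d + 2) + (M * (M * suc d) + 2 * d * M))
    regroup₁ = solve-∀
    regroup₂ : ∀ d M V L → suc d * (2 * d * V + (2 * d * L * M + 2) + (M * (M * suc d) + 2 * d * M))
                           ≡ suc d * (M * (2 * d * suc L + suc d * M) + 2) + V * suc d * (2 * d)
    regroup₂ = solve-∀

module RationalScaling where

  open import Data.Nat as ℕ using (ℕ; suc; NonZero)
  import Data.Nat.Properties as ℕ
  open import Data.Integer as ℤ using (+_)
  import Data.Integer.Properties as ℤ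
  open import Data.Rational using (ℚ; _+_; _-_; _*_; _≤_; _/_; -_; toℚᵘ; Positive)
  open import Data.Rational.Properties
    using (+-comm; toℚᵘ-injective; toℚᵘ-fromℚᵘ; toℚᵘ-homo-+; toℚᵘ-homo-*; toℚᵘ-cancel-≤;
           *-cancelʳ-≤-pos; +-monoˡ-≤; normalize-pos; module ≤-Reasoning)
  open import Data.Rational.Unnormalised as ℚᵘ using (mkℚᵘ; *≡*; *≤*) renaming (_≃_ to _≃ᵘ_)
  import Data.Rational.Unnormalised.Properties as ℚᵘ
  open import Data.Rational.Solver using (module +-*-Solver)
  open import Relation.Binary.PropositionalEquality

  fromℕ : ℕ → ℚ
  fromℕ n = + n / 1

  toℚᵘ-fromℕ : ∀ n → toℚᵘ (fromℕ n) ≃ᵘ mkℚᵘ (+ n) 0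
  toℚᵘ-fromℕ n = toℚᵘ-fromℚᵘ (mkℚᵘ (+ n) 0)

  fromℕ-homo-+ : ∀ m n → fromℕ (m ℕ.+ n) ≡ fromℕ m + fromℕ n
  fromℕ-homo-+ m n = toℚᵘ-injective (begin
      toℚᵘ (fromℕ (m ℕ.+ n))               ≈⟨ toℚᵘ-fromℕ (m ℕ.+ n) ⟩
      mkℚᵘ (+ (m ℕ.+ n)) 0                 ≈⟨ *≡* (cong (ℤ._* + 1) +[m+n]≡+m*1++n*1) ⟩
      mkℚᵘ (+ m) 0 ℚᵘ.+ mkℚᵘ (+ n) 0       ≈⟨ ℚᵘ.+-cong (toℚᵘ-fromℕ m) (toℚᵘ-fromℕ n) ⟨
      toℚᵘ (fromℕ m) ℚᵘ.+ toℚᵘ (fromℕ n)   ≈⟨ toℚᵘ-homo-+ (fromℕ m) (fromℕ n) ⟨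
      toℚᵘ (fromℕ m + fromℕ n)             ∎)
    where
    open ℚᵘ.≃-Reasoning
    +[m+n]≡+m*1++n*1 : + (m ℕ.+ n) ≡ + m ℤ.* + 1 ℤ.+ + n ℤ.* + 1
    +[m+n]≡+m*1++n*1 = trans (ℤ.pos-+ m n) (sym (cong₂ ℤ._+_ (ℤ.*-identityʳ (+ m)) (ℤ.*-identityʳ (+ n))))

  fromℕ-homo-* : ∀ m n → fromℕ (m ℕ.* n) ≡ fromℕ m * fromℕ n
  fromℕ-homo-* m n = toℚᵘ-injective (begin
      toℚᵘ (fromℕ (m ℕ.* n))               ≈⟨ toℚᵘ-fromℕ (m ℕ.* n) ⟩
      mkℚᵘ (+ (m ℕ.* n)) 0                 ≈⟨ *≡* (cong (ℤ._* + 1) (ℤ.pos-* m n)) ⟩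
      mkℚᵘ (+ m) 0 ℚᵘ.* mkℚᵘ (+ n) 0       ≈⟨ ℚᵘ.*-cong (toℚᵘ-fromℕ m) (toℚᵘ-fromℕ n) ⟨
      toℚᵘ (fromℕ m) ℚᵘ.* toℚᵘ (fromℕ n)   ≈⟨ toℚᵘ-homo-* (fromℕ m) (fromℕ n) ⟨
      toℚᵘ (fromℕ m * fromℕ n)             ∎)
    where open ℚᵘ.≃-Reasoning

  fromℕ-mono-≤ : ∀ {m n} → m ℕ.≤ n → fromℕ m ≤ fromℕ n
  fromℕ-mono-≤ {m} {n} m≤n = toℚᵘ-cancel-≤ (begin
      toℚᵘ (fromℕ m)   ≃⟨ toℚᵘ-fromℕ m ⟩
      mkℚᵘ (+ m) 0     ≤⟨ *≤* (ℤ.*-monoʳ-≤-nonNeg (+ 1) (ℤ.+≤+ m≤n)) ⟩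
      mkℚᵘ (+ n) 0     ≃⟨ toℚᵘ-fromℕ n ⟨
      toℚᵘ (fromℕ n)   ∎)
    where open ℚᵘ.≤-Reasoning

  [m/n]*n≡m : ∀ m n .{{_ : NonZero n}} → (+ m / n) * fromℕ n ≡ fromℕ m
  [m/n]*n≡m m n@(suc k) = toℚᵘ-injective (begin
      toℚᵘ ((+ m / n) * fromℕ n)            ≈⟨ toℚᵘ-homo-* (+ m / n) (fromℕ n) ⟩
      toℚᵘ (+ m / n) ℚᵘ.* toℚᵘ (fromℕ n)    ≈⟨ ℚᵘ.*-cong (toℚᵘ-fromℚᵘ (mkℚᵘ (+ m) k)) (toℚᵘ-fromℕ n) ⟩
      mkℚᵘ (+ m) k ℚᵘ.* mkℚᵘ (+ n) 0        ≈⟨ *≡* (trans (ℤ.*-identityʳ _) (cong (+ m ℤ.*_) (cong +_ (sym (ℕ.*-identityʳ n))))) ⟩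
      mkℚᵘ (+ m) 0                          ≈⟨ toℚᵘ-fromℕ m ⟨
      toℚᵘ (fromℕ m)                        ∎)
    where open ℚᵘ.≃-Reasoning

  ≤-by-scaling : ∀ {x y a b k : ℚ} .{{_ : Positive k}} → x * k + b ≡ a → a ≤ b + y * k → x ≤ y
  ≤-by-scaling {x} {y} {a} {b} {k} x*k+b≡a a≤b+y*k = *-cancelʳ-≤-pos k (begin
      x * k            ≡⟨ cancel (x * k) b ⟨
      x * k + b - b    ≡⟨ cong (_- b) x*k+b≡a ⟩
      a - b            ≤⟨ +-monoˡ-≤ (- b) a≤b+y*k ⟩
      b + y * k - b    ≡⟨ trans (cong (_- b) (+-comm b (y * k))) (cancel (y * k) b) ⟩
      y * k            ∎)
    where
    open ≤-Reasoning
    cancel : ∀ r s → r + s - s ≡ r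
    cancel = solve 2 (λ r s → r :+ s :- s := r) refl where open +-*-Solver

  scaled-identity : ∀ (u w D M L N P PM : ℚ) → u * D ≡ N → w * (fromℕ 2 * D) ≡ P → P * M ≡ PM →
    (PM * (u - L - fromℕ 1) - w * (M - fromℕ 1) * (PM - fromℕ 2)) * (fromℕ 2 * D)
      + P * (M * (fromℕ 2 * D * (fromℕ 1 + L) + PM) + fromℕ 2)
    ≡ PM * (fromℕ 2 * N + fromℕ 2 + P)
  scaled-identity u w D M L _ _ _ refl refl refl =
    solve 5 (λ u w D M L →
        let P = w :* (two :* D) ; PM = P :* M in
        (PM :* (u :- L :- one) :- w :* (M :- one) :* (PM :- two)) :* (two :* D)
          :+ P :* (M :* (two :* D :* (one :+ L) :+ PM) :+ two)
        := PM :* (two :* (u :* D) :+ two :+ P))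
      refl u w D M L
    where
    open +-*-Solver
    one = con (fromℕ 1)
    two = con (fromℕ 2)

  fromℕ-[p*M]*[2n+2+p] : ∀ p M n →
    fromℕ (p ℕ.* M ℕ.* (2 ℕ.* n ℕ.+ 2 ℕ.+ p)) ≡ fromℕ (p ℕ.* M) * (fromℕ 2 * fromℕ n + fromℕ 2 + fromℕ p)
  fromℕ-[p*M]*[2n+2+p] p M n = begin
      fromℕ (p ℕ.* M ℕ.* (2 ℕ.* n ℕ.+ 2 ℕ.+ p))     ≡⟨ fromℕ-homo-* (p ℕ.* M) (2 ℕ.* n ℕ.+ 2 ℕ.+ p) ⟩
      PM * fromℕ (2 ℕ.* n ℕ.+ 2 ℕ.+ p)              ≡⟨ cong (PM *_) (fromℕ-homo-+ (2 ℕ.* n ℕ.+ 2) p) ⟩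
      PM * (fromℕ (2 ℕ.* n ℕ.+ 2) + fromℕ p)        ≡⟨ cong (λ x → PM * (x + fromℕ p)) (fromℕ-homo-+ (2 ℕ.* n) 2) ⟩
      PM * (fromℕ (2 ℕ.* n) + fromℕ 2 + fromℕ p)    ≡⟨ cong (λ x → PM * (x + fromℕ 2 + fromℕ p)) (fromℕ-homo-* 2 n) ⟩
      PM * (fromℕ 2 * fromℕ n + fromℕ 2 + fromℕ p)  ∎
    where
    open ≡-Reasoning
    PM = fromℕ (p ℕ.* M)

  fromℕ-p*[M*[2d[1+L]+p*M]+2] : ∀ p d M L →
    fromℕ (p ℕ.* (M ℕ.* (2 ℕ.* d ℕ.* suc L ℕ.+ p ℕ.* M) ℕ.+ 2))
      ≡ fromℕ p * (fromℕ M * (fromℕ 2 * fromℕ d * (fromℕ 1 + fromℕ L) + fromℕ (p ℕ.* M)) + fromℕ 2)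
  fromℕ-p*[M*[2d[1+L]+p*M]+2] p d M L = begin
      fromℕ (p ℕ.* (M ℕ.* K ℕ.+ 2))                  ≡⟨ fromℕ-homo-* p (M ℕ.* K ℕ.+ 2) ⟩
      P * fromℕ (M ℕ.* K ℕ.+ 2)                      ≡⟨ cong (P *_) (fromℕ-homo-+ (M ℕ.* K) 2) ⟩
      P * (fromℕ (M ℕ.* K) + two)                    ≡⟨ cong (λ x → P * (x + two)) (fromℕ-homo-* M K) ⟩
      P * (fromℕ M * fromℕ K + two)                  ≡⟨ cong (λ x → P * (fromℕ M * x + two)) (fromℕ-homo-+ (2 ℕ.* d ℕ.* suc L) (p ℕ.* M)) ⟩
      P * (fromℕ M * (fromℕ (2 ℕ.* d ℕ.* suc L) + PM) + two)
        ≡⟨ cong (λ x → P * (fromℕ M * (x + PM) + two)) (fromℕ-homo-* (2 ℕ.* d) (suc L)) ⟩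
      P * (fromℕ M * (fromℕ (2 ℕ.* d) * fromℕ (suc L) + PM) + two)
        ≡⟨ cong₂ (λ x y → P * (fromℕ M * (x * y + PM) + two)) (fromℕ-homo-* 2 d) (fromℕ-homo-+ 1 L) ⟩
      P * (fromℕ M * (two * fromℕ d * (fromℕ 1 + fromℕ L) + PM) + two) ∎
    where
    open ≡-Reasoning
    K = 2 ℕ.* d ℕ.* suc L ℕ.+ p ℕ.* M
    P = fromℕ p
    PM = fromℕ (p ℕ.* M)
    two = fromℕ 2

  bound-in-ℚ : ∀ d n M L v .{{_ : NonZero d}} .{{_ : NonZero (2 ℕ.* d)}} → let p = suc d in
    p ℕ.* M ℕ.* (2 ℕ.* n ℕ.+ 2 ℕ.+ p) ℕ.≤ p ℕ.* (M ℕ.* (2 ℕ.* d ℕ.* suc L ℕ.+ p ℕ.* M) ℕ.+ 2) ℕ.+ v ℕ.* (2 ℕ.* d) →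
    fromℕ (p ℕ.* M) * (+ n / d - fromℕ L - fromℕ 1) - (+ p / (2 ℕ.* d)) * (fromℕ M - fromℕ 1) * (fromℕ (p ℕ.* M) - fromℕ 2)
      ≤ fromℕ v
  bound-in-ℚ d n M L v A≤B+v*2d = ≤-by-scaling {{normalize-pos (2 ℕ.* d) 1}} X*2d+B≡A A≤B+v*2d′
    where
    open ≡-Reasoning
    p = suc d
    A = p ℕ.* M ℕ.* (2 ℕ.* n ℕ.+ 2 ℕ.+ p)
    B = p ℕ.* (M ℕ.* (2 ℕ.* d ℕ.* suc L ℕ.+ p ℕ.* M) ℕ.+ 2)
    w = + p / (2 ℕ.* d)
    X = fromℕ (p ℕ.* M) * (+ n / d - fromℕ L - fromℕ 1) - w * (fromℕ M - fromℕ 1) * (fromℕ (p ℕ.* M) - fromℕ 2)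
    w*2d≡p : w * (fromℕ 2 * fromℕ d) ≡ fromℕ p
    w*2d≡p = trans (cong (w *_) (sym (fromℕ-homo-* 2 d))) ([m/n]*n≡m p (2 ℕ.* d))
    X*2d+B≡A : X * fromℕ (2 ℕ.* d) + fromℕ B ≡ fromℕ A
    X*2d+B≡A = begin
      X * fromℕ (2 ℕ.* d) + fromℕ B
        ≡⟨ cong₂ (λ x y → X * x + y) (fromℕ-homo-* 2 d) (fromℕ-p*[M*[2d[1+L]+p*M]+2] p d M L) ⟩
      X * (fromℕ 2 * fromℕ d) + fromℕ p * (fromℕ M * (fromℕ 2 * fromℕ d * (fromℕ 1 + fromℕ L) + fromℕ (p ℕ.* M)) + fromℕ 2)
        ≡⟨ scaled-identity (+ n / d) w (fromℕ d) (fromℕ M) (fromℕ L) (fromℕ n) (fromℕ p) (fromℕ (p ℕ.* M))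
             ([m/n]*n≡m n d) w*2d≡p (sym (fromℕ-homo-* p M)) ⟩
      fromℕ (p ℕ.* M) * (fromℕ 2 * fromℕ n + fromℕ 2 + fromℕ p)
        ≡⟨ fromℕ-[p*M]*[2n+2+p] p M n ⟨
      fromℕ A ∎
    A≤B+v*2d′ : fromℕ A ≤ fromℕ B + fromℕ v * fromℕ (2 ℕ.* d)
    A≤B+v*2d′ = subst (fromℕ A ≤_) (trans (fromℕ-homo-+ B (v ℕ.* (2 ℕ.* d))) (cong (_+_ (fromℕ B)) (fromℕ-homo-* v (2 ℕ.* d))))
                  (fromℕ-mono-≤ A≤B+v*2d)

open import Defs
open import Data.Nat using (ℕ; suc; _≥_; _∸_; NonZero) renaming (_/_ to _div_; _*_ to _*ℕ_)
open import Data.Nat.Primality using (Prime)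
open import Data.Integer using (+_)
open import Data.Rational using (ℚ; _+_; _-_; _*_; _≤_; _/_)
open HyperfactorialValuation using (hyperfactorial-bound)
open RationalScaling using (bound-in-ℚ)

mainTheorem1 : (p n : ℕ) → Prime p → n ≥ 1 →
  -- the following instances are automatic consequences of Prime p (p ≥ 2)
  .{{_ : NonZero p}} → .{{_ : NonZero (p ∸ 1)}} → .{{_ : NonZero (2 *ℕ (p ∸ 1))}} →
  (v L : ℕ) → IsValuation p (H n) v → IsFloorLog p n L →
  let M = n div p in
  ((+ (p *ℕ M)) / 1) * (((+ n) / (p ∸ 1)) - (+ L / 1) - (+ 1 / 1))
    - ((+ p) / (2 *ℕ (p ∸ 1))) * ((+ M / 1) - (+ 1 / 1)) * ((+ (p *ℕ M) / 1) - (+ 2 / 1))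
    ≤ (+ v / 1)
mainTheorem1 (suc d) n _ _ v L ν≡v ⌊log⌋≡L =
  bound-in-ℚ d n (n div suc d) L v (hyperfactorial-bound d n v L ν≡v ⌊log⌋≡L)
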